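{- Let $\mathbf{s}$ be a Sturmian word of slope $\theta$ with words $V_k$ and formal intercept $(b_k)_{k\ge1}$ as in the context. For any $k\ge0$, the word $V_k$ is a prefix of $V_{k+1}$ if and only if: when $k$ is odd, $(b_1,\dots,b_{k+1})\ne(0,a_2,0,a_4,\dots,0,a_{k+1})$; when $k$ is even, $(b_1,\dots,b_{k+1})\ne(a_1-1,0,a_3,0,\dots,0,a_{k+1})$ (for $k=0$ this reads $b_1\ne a_1-1$).
   Context: $\theta=[0;a_1,a_2,\dots]\in(0,1)$ irrational with $q_{ -1}=0$, $q_0=1$, $q_k=a_kq_{k-1}+q_{k-2}$. Words $M_0=0$, $M_1=0^{a_1-1}1$, $M_k=M_{k-1}^{a_k}M_{k-2}$. A Sturmian word of slope $\theta$ is $s_1s_2\cdots$ or $s'_1s'_2\cdots$ for some $\rho\in[0,1)$, with $s_n=\lfloor n\theta+\rho\rfloor-\lfloor(n-1)\theta+\rho\rfloor$, $s'_n=\lceil n\theta+\rho\rceil-\lceil(n-1)\theta+\rho\rceil$. For $k\ge1$, $V_k$ is the conjugate of $M_k$ (a word $RT$ with $M_k=TR$, $0\le|T|<q_k$) whose first $q_k-1$ letters coincide with those of $\mathbf{s}$, written $V_k=R_kT_k$, $M_k=T_kR_k$, $R_k$ non-empty, $t_k=|T_k|$; $V_0=0$, $t_0=0$. The formal intercept is $b_1=t_1$, $b_{k+1}=(t_{k+1}-t_k)/q_k$ ($k\ge1$). -}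

module Defs where

open import Data.Nat using (ℕ; zero; suc; _+_; _*_; _∸_; _<_; _≤_)
open import Data.Integer as ℤ using (ℤ; +_)
open import Data.Rational as ℚ using (ℚ)
open import Data.Rational.Unnormalised as Q using (ℚᵘ; mkℚᵘ)
open import Data.List using (List; []; _∷_; _++_; replicate; concat; take; drop; map; upTo)
open import Data.Product using (Σ; ∃; ∃-syntax; _×_; _,_)
open import Data.Sum using (_⊎_)
open import Relation.Nullary using (¬_)
open import Relation.Binary.PropositionalEquality using (_≡_)

-- Continued fraction digits: a : ℕ → ℕ, with a 0 unused (θ = [0; a 1, a 2, ...]).
PositiveDigits : (ℕ → ℕ) → Set
PositiveDigits a = ∀ k → 1 ≤ k → 1 ≤ a k

qp : (ℕ → ℕ) → ℕ → ℕ × ℕ   -- (q_{k-1} , q_k)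
qp a zero = 0 , 1
qp a (suc k) with qp a k
... | (x , y) = y , a (suc k) * y + x

pp : (ℕ → ℕ) → ℕ → ℕ × ℕ   -- (p_{k-1} , p_k)
pp a zero = 1 , 0
pp a (suc k) with pp a k
... | (x , y) = y , a (suc k) * y + x

q : (ℕ → ℕ) → ℕ → ℕ
q a k = Data.Product.proj₂ (qp a k)

p : (ℕ → ℕ) → ℕ → ℕ
p a k = Data.Product.proj₂ (pp a k)

-- the convergent p_k / q_k as an (unnormalised) rational (q_k ≥ 1 under PositiveDigits)
conv : (ℕ → ℕ) → ℕ → ℚᵘ
conv a k = mkℚᵘ (+ p a k) (q a k ∸ 1)

-- θ = [0; a_1, a_2, ...] as a Dedekind cut: even convergents increase to θ,
-- odd convergents decrease to θ.
θLower : (ℕ → ℕ) → ℚᵘ → Set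
θLower a x = ∃[ k ] (x Q.< conv a (2 * k))

θUpper : (ℕ → ℕ) → ℚᵘ → Set
θUpper a x = ∃[ k ] (conv a (suc (2 * k)) Q.< x)

record Real : Set₁ where
  field
    L : ℚᵘ → Set
    U : ℚᵘ → Set
    L-inhabited : ∃[ x ] L x
    U-inhabited : ∃[ x ] U x
    L-down : ∀ x y → x Q.< y → L y → L x
    U-up : ∀ x y → x Q.< y → U x → U y
    L-round : ∀ x → L x → ∃[ y ] (x Q.< y × L y)
    U-round : ∀ y → U y → ∃[ x ] (x Q.< y × U x)
    disjoint : ∀ x → ¬ (L x × U x)
    located : ∀ x y → x Q.< y → L x ⊎ U y

open Real public

InUnitInterval : Real → Set
InUnitInterval ρ = ¬ U ρ (mkℚᵘ (+ 0) 0) × U ρ (mkℚᵘ (+ 1) 0)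

ℕtoℚᵘ : ℕ → ℚᵘ
ℕtoℚᵘ n = mkℚᵘ (+ n) 0

ℤtoℚᵘ : ℤ → ℚᵘ
ℤtoℚᵘ m = mkℚᵘ m 0

-- n θ + ρ < m
SumLt : (ℕ → ℕ) → Real → ℕ → ℤ → Set
SumLt a ρ n m = ∃[ u ] ∃[ v ] (θUpper a u × U ρ v × (ℕtoℚᵘ n Q.* u Q.+ v) Q.< ℤtoℚᵘ m)

-- m < n θ + ρ
SumGt : (ℕ → ℕ) → Real → ℕ → ℤ → Set
SumGt a ρ n m = ∃[ u ] ∃[ v ] (θLower a u × L ρ v × ℤtoℚᵘ m Q.< (ℕtoℚᵘ n Q.* u Q.+ v))

IsFloor : (ℕ → ℕ) → Real → ℕ → ℤ → Set
IsFloor a ρ n f = ¬ SumLt a ρ n f × SumLt a ρ n (f ℤ.+ ℤ.+ 1)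

IsCeil : (ℕ → ℕ) → Real → ℕ → ℤ → Set
IsCeil a ρ n c = SumGt a ρ n (c ℤ.- ℤ.+ 1) × ¬ SumGt a ρ n c

-- Infinite words s_1 s_2 ... are functions ℕ → ℕ (index 0 unused; letters 0,1).
-- s is a Sturmian word of slope θ = [0; a_1, a_2, ...]
Sturmian : (ℕ → ℕ) → (ℕ → ℕ) → Set₁
Sturmian a s = Σ Real λ ρ → InUnitInterval ρ ×
  ( (Σ (ℕ → ℤ) λ f → ((∀ n → IsFloor a ρ n (f n)) × (∀ n → + s (suc n) ≡ f (suc n) ℤ.- f n)))
  ⊎ (Σ (ℕ → ℤ) λ c → ((∀ n → IsCeil a ρ n (c n)) × (∀ n → + s (suc n) ≡ c (suc n) ℤ.- c n))))

pref : (ℕ → ℕ) → ℕ → List ℕ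
pref s m = map (λ i → s (suc i)) (upTo m)

-- standard words M_k (pair (M_{k-1}, M_k), with M_0 = 0, M_1 = 0^{a_1 - 1} 1)
MM : (ℕ → ℕ) → ℕ → List ℕ × List ℕ
MM a zero = [] , 0 ∷ []
MM a (suc zero) = (0 ∷ []) , (replicate (a 1 ∸ 1) 0 ++ 1 ∷ [])
MM a (suc (suc k)) with MM a (suc k)
... | (x , y) = y , (concat (replicate (a (suc (suc k))) y) ++ x)

M : (ℕ → ℕ) → ℕ → List ℕ
M a k = Data.Product.proj₂ (MM a k)

-- the conjugate R T of M_k = T R with |T| = t
conj : (ℕ → ℕ) → ℕ → ℕ → List ℕ
conj a k t = drop t (M a k) ++ take t (M a k)

-- t : ℕ → ℕ is the sequence (t_k): for each k, 0 ≤ t_k < q_k and the conjugate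
-- V_k = R_k T_k (|T_k| = t_k) agrees with s on its first q_k - 1 letters.
-- (For k = 0 this forces t_0 = 0, V_0 = 0.)
IsTSeq : (ℕ → ℕ) → (ℕ → ℕ) → (ℕ → ℕ) → Set
IsTSeq a s t = ∀ k → t k < q a k × take (q a k ∸ 1) (conj a k (t k)) ≡ pref s (q a k ∸ 1)

V : (ℕ → ℕ) → (ℕ → ℕ) → ℕ → List ℕ
V a t k = conj a k (t k)

-- rational division z / d (d ≠ 0 under PositiveDigits; 0 returned for d = 0)
divℚ : ℤ → ℕ → ℚ
divℚ z zero = ℚ.0ℚ
divℚ z (suc d) = z ℚ./ suc d

-- formal intercept: b_1 = t_1, b_{k+1} = (t_{k+1} - t_k) / q_k  (b 0 unused)
b : (ℕ → ℕ) → (ℕ → ℕ) → ℕ → ℚ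
b a t zero = ℚ.0ℚ
b a t (suc zero) = divℚ (+ t 1) 1
b a t (suc (suc k)) = divℚ (+ t (suc (suc k)) ℤ.- + t (suc k)) (q a (suc k))

isOdd : ℕ → Set
isOdd n = ∃[ m ] (n ≡ suc (2 * m))

isEven : ℕ → Set
isEven n = ∃[ m ] (n ≡ 2 * m)

natℚ : ℕ → ℚ
natℚ n = divℚ (+ n) 1

ExceptionalTuple : (ℕ → ℕ) → (ℕ → ℕ) → ℕ → Set
ExceptionalTuple a t k =
  (isOdd k → ∀ i → 1 ≤ i → i ≤ suc k →
      (isOdd i → b a t i ≡ natℚ 0) × (isEven i → b a t i ≡ natℚ (a i)))
  × (isEven k → (b a t 1 ≡ natℚ (a 1 ∸ 1)) × (∀ i → 2 ≤ i → i ≤ suc k →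
      (isEven i → b a t i ≡ natℚ 0) × (isOdd i → b a t i ≡ natℚ (a i))))

-- V_k is a rotation of the standard word M_k, and V_{k+1} a rotation of M_{k+1} = M_k^{a_{k+1}} M_{k−1}.
-- Since M_k M_{k−1} and M_{k−1} M_k differ only in their last two letters, every window of length q_k of
-- the cyclic word M_{k+1} is a rotation of M_k, except the window starting at position q_{k+1} − 1, which
-- agrees with one only on its first q_k − 1 letters. A rotation of M_k is determined by its first q_k − 1
-- letters, because M_k is primitive: its length q_k and its number of 1s p_k are coprime. Hence
-- t_{k+1} = b_{k+1} q_k + t_k, and V_k is a prefix of V_{k+1} exactly when t_{k+1} ≠ q_{k+1} − 1.
-- Unwinding t_{k+1} = q_{k+1} − 1 through q_{k+1} − 1 = a_{k+1} q_k + (q_{k−1} − 1) yields the exceptional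
-- values of (b_1, …, b_{k+1}).

module Submission where

open import Defs

open import Data.Empty using (⊥-elim)
import Data.Integer as ℤ
import Data.Integer.Properties as ℤP
open import Data.List using (List; []; _∷_; _++_; length; replicate; concat; take; drop; map; applyUpTo)
open import Data.List.Properties
  using (length-++; length-replicate; length-take; length-drop; ++-assoc; ++-identityʳ; ++-cancelˡ;
         take++drop≡id; drop-drop)
open import Data.List.Relation.Binary.Prefix.Heterogeneous using (Prefix; []; _∷_)
open import Data.Nat
open import Data.Nat.Coprimality using (Coprime)
open import Data.Nat.Divisibility using (_∣_; divides; ∣m+n∣m⇒∣n; ∣m⇒∣m*n; ∣n⇒∣m*n; ∣1⇒≡1)
open import Data.Nat.DivMod using (_/_; _%_; m≡m%n+[m/n]*n; m%n<n)
open import Data.Nat.ListAction using (sum)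
open import Data.Nat.ListAction.Properties using (sum-++)
open import Data.Nat.Properties
open import Data.Nat.Tactic.RingSolver using (solve-∀)
open import Data.Product using (_×_; ∃-syntax; _,_; proj₁; proj₂)
open import Data.Product.Function.NonDependent.Propositional using (_×-⇔_)
open import Data.Rational using (ℚ)
import Data.Rational.Properties as ℚP
open import Data.Rational.Unnormalised using (mkℚᵘ; *≡*)
open import Data.Sum using (_⊎_; inj₁; inj₂)
open import Function.Bundles using (_⇔_; mk⇔; module Equivalence)
open import Function.Properties.Equivalence using () renaming (refl to ⇔-refl; sym to ⇔-sym; trans to ⇔-trans)
open import Relation.Binary.Definitions using (Tri; tri<; tri≈; tri>)
open import Relation.Binary.PropositionalEquality
  using (_≡_; _≢_; refl; sym; trans; cong; cong₂; subst; subst₂; module ≡-Reasoning)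
open import Relation.Nullary using (¬_; Dec; yes; no)

private
  variable
    X : Set

<⊎≡+ : ∀ k x → x < k ⊎ ∃[ y ] x ≡ k + y
<⊎≡+ k x with x <? k
... | yes x<k = inj₁ x<k
... | no  x≮k = inj₂ (x ∸ k , sym (m+[n∸m]≡n (≮⇒≥ x≮k)))

divMod : ∀ x n → 1 ≤ n → ∃[ j ] ∃[ r ] (r < n × x ≡ j * n + r)
divMod x (suc n) _ = x / suc n , x % suc n , m%n<n x (suc n) ,
                     trans (m≡m%n+[m/n]*n x (suc n)) (+-comm (x % suc n) _)

divMod-unique : ∀ {n} j j′ r r′ → r < n → r′ < n → j * n + r ≡ j′ * n + r′ → j ≡ j′ × r ≡ r′
divMod-unique         zero    zero     r r′ _   _    e = refl , e
divMod-unique {n}     zero    (suc j′) r r′ r<n _    e =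
  ⊥-elim (<⇒≱ r<n (≤-trans (m≤m+n n (j′ * n + r′)) (≤-reflexive (sym (trans e (+-assoc n _ r′))))))
divMod-unique {n}     (suc j) zero     r r′ _   r′<n e =
  ⊥-elim (<⇒≱ r′<n (≤-trans (m≤m+n n (j * n + r)) (≤-reflexive (trans (sym (+-assoc n _ r)) e))))
divMod-unique {n}     (suc j) (suc j′) r r′ r<n r′<n e =
  let j≡j′ , r≡r′ = divMod-unique j j′ r r′ r<n r′<n
                      (+-cancelˡ-≡ n _ _ (trans (sym (+-assoc n (j * n) r)) (trans e (+-assoc n (j′ * n) r′))))
  in cong suc j≡j′ , r≡r′

-- Total indexing with junk value 0 past the end; it is only ever used at indices within range.
at : List ℕ → ℕ → ℕ
at []       i       = 0
at (x ∷ xs) zero    = x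
at (x ∷ xs) (suc i) = at xs i

at-++ˡ : ∀ xs ys i → i < length xs → at (xs ++ ys) i ≡ at xs i
at-++ˡ (x ∷ xs) ys zero    _       = refl
at-++ˡ (x ∷ xs) ys (suc i) (s≤s p) = at-++ˡ xs ys i p

at-++ʳ : ∀ xs ys i → at (xs ++ ys) (length xs + i) ≡ at ys i
at-++ʳ []       ys i = refl
at-++ʳ (x ∷ xs) ys i = at-++ʳ xs ys i

at-++-length : ∀ xs y ys → at (xs ++ y ∷ ys) (length xs) ≡ y
at-++-length []       y ys = refl
at-++-length (x ∷ xs) y ys = at-++-length xs y ys

at-drop : ∀ t xs i → at (drop t xs) i ≡ at xs (t + i)
at-drop zero    xs       i = refl
at-drop (suc t) []       i = refl
at-drop (suc t) (x ∷ xs) i = at-drop t xs i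

at-take : ∀ n xs i → i < n → at (take n xs) i ≡ at xs i
at-take (suc n) []       i       _       = refl
at-take (suc n) (x ∷ xs) zero    _       = refl
at-take (suc n) (x ∷ xs) (suc i) (s≤s p) = at-take n xs i p

at-replicate : ∀ n x i → i < n → at (replicate n x) i ≡ x
at-replicate (suc n) x zero    _       = refl
at-replicate (suc n) x (suc i) (s≤s p) = at-replicate n x i p

at-map-applyUpTo : ∀ (g f : ℕ → ℕ) n i → i < n → at (map g (applyUpTo f n)) i ≡ g (f i)
at-map-applyUpTo g f (suc n) zero    _       = refl
at-map-applyUpTo g f (suc n) (suc i) (s≤s p) = at-map-applyUpTo g (λ j → f (suc j)) n i p

Prefix⇒at : ∀ {xs ys} → Prefix _≡_ xs ys → ∀ i → i < length xs → at xs i ≡ at ys i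
Prefix⇒at (e ∷ _) zero    _       = e
Prefix⇒at (_ ∷ p) (suc i) (s≤s l) = Prefix⇒at p i l

at⇒Prefix : ∀ xs ys → length xs ≤ length ys → (∀ i → i < length xs → at xs i ≡ at ys i) →
            Prefix _≡_ xs ys
at⇒Prefix []       ys       _       _ = []
at⇒Prefix (x ∷ xs) (y ∷ ys) (s≤s l) f = f 0 z<s ∷ at⇒Prefix xs ys l (λ i p → f (suc i) (s≤s p))

-- The last letter is recovered from the sum.
≡-from-init-sum : ∀ xs ys → length xs ≡ length ys → sum xs ≡ sum ys →
                  (∀ i → suc i < length xs → at xs i ≡ at ys i) → xs ≡ ys
≡-from-init-sum []            []            _ _ _ = refl
≡-from-init-sum (x ∷ [])      (y ∷ [])      _ s _ =
  cong (_∷ []) (trans (sym (+-identityʳ x)) (trans s (+-identityʳ y)))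
≡-from-init-sum (x ∷ x′ ∷ xs) (y ∷ y′ ∷ ys) l s f =
  cong₂ _∷_ x≡y (≡-from-init-sum (x′ ∷ xs) (y′ ∷ ys) (suc-injective l) tail-sums
                   (λ i p → f (suc i) (s≤s p)))
  where
  x≡y : x ≡ y
  x≡y = f 0 (s≤s (s≤s z≤n))
  tail-sums : sum (x′ ∷ xs) ≡ sum (y′ ∷ ys)
  tail-sums = +-cancelˡ-≡ x _ _ (trans s (cong (_+ sum (y′ ∷ ys)) (sym x≡y)))
≡-from-init-sum []            (_ ∷ _)       () _ _
≡-from-init-sum (_ ∷ _)       []            () _ _
≡-from-init-sum (_ ∷ [])      (_ ∷ _ ∷ _)   () _ _
≡-from-init-sum (_ ∷ _ ∷ _)   (_ ∷ [])      () _ _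

take-++-≤ : ∀ n (xs ys : List X) → n ≤ length xs → take n (xs ++ ys) ≡ take n xs
take-++-≤ zero    xs       ys _       = refl
take-++-≤ (suc n) (x ∷ xs) ys (s≤s p) = cong (x ∷_) (take-++-≤ n xs ys p)

take-length-++ : ∀ (xs ys : List X) → take (length xs) (xs ++ ys) ≡ xs
take-length-++ []       ys = refl
take-length-++ (x ∷ xs) ys = cong (x ∷_) (take-length-++ xs ys)

drop-++-≤ : ∀ n (xs ys : List X) → n ≤ length xs → drop n (xs ++ ys) ≡ drop n xs ++ ys
drop-++-≤ zero    xs       ys _       = refl
drop-++-≤ (suc n) (x ∷ xs) ys (s≤s p) = drop-++-≤ n xs ys p

take-+ : ∀ m n (xs : List X) → take (m + n) xs ≡ take m xs ++ take n (drop m xs)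
take-+ zero    n xs       = refl
take-+ (suc m) zero    []       = refl
take-+ (suc m) (suc n) []       = refl
take-+ (suc m) n       (x ∷ xs) = cong (x ∷_) (take-+ m n xs)

rotate : List X → ℕ → List X
rotate xs t = drop t xs ++ take t xs

length-rotate : ∀ (xs : List X) t → t ≤ length xs → length (rotate xs t) ≡ length xs
length-rotate xs t t≤ = begin
  length (drop t xs ++ take t xs)          ≡⟨ length-++ (drop t xs) ⟩
  length (drop t xs) + length (take t xs)  ≡⟨ cong₂ _+_ (length-drop t xs) (length-take t xs) ⟩
  (length xs ∸ t) + (t ⊓ length xs)        ≡⟨ cong ((length xs ∸ t) +_) (m≤n⇒m⊓n≡m t≤) ⟩
  (length xs ∸ t) + t                      ≡⟨ m∸n+n≡m t≤ ⟩
  length xs                                ∎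
  where open ≡-Reasoning

sum-rotate : ∀ xs t → sum (rotate xs t) ≡ sum xs
sum-rotate xs t = begin
  sum (drop t xs ++ take t xs)      ≡⟨ sum-++ (drop t xs) (take t xs) ⟩
  sum (drop t xs) + sum (take t xs) ≡⟨ +-comm (sum (drop t xs)) _ ⟩
  sum (take t xs) + sum (drop t xs) ≡⟨ sum-++ (take t xs) (drop t xs) ⟨
  sum (take t xs ++ drop t xs)      ≡⟨ cong sum (take++drop≡id t xs) ⟩
  sum xs                            ∎
  where open ≡-Reasoning

at-rotate : ∀ xs t i → t ≤ length xs → i < length xs → at (rotate xs t) i ≡ at (xs ++ xs) (t + i)
at-rotate xs t i t≤ i< = begin
  at (rotate xs t) i                                ≡⟨ at-++ˡ (rotate xs t) (drop t xs) i i<′ ⟨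
  at (rotate xs t ++ drop t xs) i                   ≡⟨ cong (λ w → at w i) (++-assoc (drop t xs) (take t xs) _) ⟩
  at (drop t xs ++ (take t xs ++ drop t xs)) i      ≡⟨ cong (λ w → at (drop t xs ++ w) i) (take++drop≡id t xs) ⟩
  at (drop t xs ++ xs) i                            ≡⟨ cong (λ w → at w i) (drop-++-≤ t xs xs t≤) ⟨
  at (drop t (xs ++ xs)) i                          ≡⟨ at-drop t (xs ++ xs) i ⟩
  at (xs ++ xs) (t + i)                             ∎
  where
  open ≡-Reasoning
  i<′ : i < length (rotate xs t)
  i<′ = subst (i <_) (sym (length-rotate xs t t≤)) i<

rotate-rotate : ∀ (xs : List X) r d → r + d ≤ length xs → rotate (rotate xs r) d ≡ rotate xs (r + d)
rotate-rotate xs r d r+d≤ = begin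
  drop d (drop r xs ++ take r xs) ++ take d (drop r xs ++ take r xs)
    ≡⟨ cong₂ _++_ (drop-++-≤ d (drop r xs) (take r xs) d≤) (take-++-≤ d (drop r xs) (take r xs) d≤) ⟩
  (drop d (drop r xs) ++ take r xs) ++ take d (drop r xs)
    ≡⟨ cong (λ w → (w ++ take r xs) ++ take d (drop r xs)) (drop-drop r d xs) ⟩
  (drop (r + d) xs ++ take r xs) ++ take d (drop r xs)
    ≡⟨ ++-assoc (drop (r + d) xs) (take r xs) _ ⟩
  drop (r + d) xs ++ (take r xs ++ take d (drop r xs))
    ≡⟨ cong (drop (r + d) xs ++_) (take-+ r d xs) ⟨
  drop (r + d) xs ++ take (r + d) xs
    ∎
  where
  open ≡-Reasoning
  d≤ : d ≤ length (drop r xs)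
  d≤ = subst (d ≤_) (sym (length-drop r xs))
         (subst (_≤ length xs ∸ r) (m+n∸m≡n r d) (∸-monoˡ-≤ r r+d≤))

power : ℕ → List X → List X
power n z = concat (replicate n z)

length-power : ∀ n (z : List X) → length (power n z) ≡ n * length z
length-power zero    z = refl
length-power (suc n) z = trans (length-++ z) (cong (length z +_) (length-power n z))

sum-power : ∀ n z → sum (power n z) ≡ n * sum z
sum-power zero    z = refl
sum-power (suc n) z = trans (sum-++ z (power n z)) (cong (sum z +_) (sum-power n z))

power-+ : ∀ m n (z : List X) → power (m + n) z ≡ power m z ++ power n z
power-+ zero    n z = refl
power-+ (suc m) n z = trans (cong (z ++_) (power-+ m n z)) (sym (++-assoc z (power m z) (power n z)))

power-comm : ∀ n (z : List X) → z ++ power n z ≡ power n z ++ z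
power-comm zero    z = ++-identityʳ z
power-comm (suc n) z = trans (cong (z ++_) (power-comm n z)) (sym (++-assoc z (power n z) z))

at-power-++ : ∀ n z ys i → at (power n z ++ ys) (n * length z + i) ≡ at ys i
at-power-++ zero    z ys i = refl
at-power-++ (suc n) z ys i = begin
  at ((z ++ power n z) ++ ys) (length z + n * length z + i)
    ≡⟨ cong₂ at (++-assoc z (power n z) ys) (+-assoc (length z) _ i) ⟩
  at (z ++ (power n z ++ ys)) (length z + (n * length z + i)) ≡⟨ at-++ʳ z _ _ ⟩
  at (power n z ++ ys) (n * length z + i)                     ≡⟨ at-power-++ n z ys i ⟩
  at ys i                                                     ∎
  where open ≡-Reasoning

CommonPower : List X → List X → Set
CommonPower xs ys = ∃[ z ] ∃[ m ] ∃[ n ] (xs ≡ power m z × ys ≡ power n z)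

commuting-prefix : ∀ (xs ys : List X) → xs ++ ys ≡ ys ++ xs → length xs ≤ length ys →
                   ys ≡ xs ++ drop (length xs) ys
commuting-prefix xs ys e xs≤ys = trans (sym (take++drop≡id (length xs) ys)) (cong (_++ drop (length xs) ys) take≡)
  where
  take≡ : take (length xs) ys ≡ xs
  take≡ = trans (sym (take-++-≤ (length xs) ys xs xs≤ys))
            (trans (cong (take (length xs)) (sym e)) (take-length-++ xs ys))

-- Lyndon–Schützenberger, by induction on a bound N for the total length.
mutual
  commute⇒CommonPower : ∀ N (xs ys : List X) → length xs + length ys ≤ N → xs ++ ys ≡ ys ++ xs →
                        CommonPower xs ys
  commute⇒CommonPower N       []       ys       _ _ = ys , 0 , 1 , refl , sym (++-identityʳ ys)
  commute⇒CommonPower N       (x ∷ xs) []       _ _ = x ∷ xs , 1 , 0 , sym (++-identityʳ (x ∷ xs)) , refl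
  commute⇒CommonPower zero    (x ∷ xs) (y ∷ ys) () _
  commute⇒CommonPower (suc N) (x ∷ xs) (y ∷ ys) ≤N e with ≤-total (length (x ∷ xs)) (length (y ∷ ys))
  ... | inj₁ xs≤ys = commute⇒CommonPower-shorter N (x ∷ xs) (y ∷ ys) z<s ≤N e xs≤ys
  ... | inj₂ ys≤xs =
    let z , m , n , ys≡ , xs≡ = commute⇒CommonPower-shorter N (y ∷ ys) (x ∷ xs) z<s
                                  (subst (_≤ suc N) (+-comm (length (x ∷ xs)) _) ≤N) (sym e) ys≤xs
    in z , n , m , xs≡ , ys≡

  commute⇒CommonPower-shorter : ∀ N (xs ys : List X) → 1 ≤ length xs → length xs + length ys ≤ suc N →
    xs ++ ys ≡ ys ++ xs → length xs ≤ length ys → CommonPower xs ys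
  commute⇒CommonPower-shorter {X = X} N xs ys 1≤ ≤N e xs≤ys =
    let z , m , n , xs≡ , ys′≡ = commute⇒CommonPower N xs ys′ ≤N′ e′
    in z , m , m + n , xs≡ , trans ys≡ (trans (cong₂ _++_ xs≡ ys′≡) (sym (power-+ m n z)))
    where
    ys′ : List X
    ys′ = drop (length xs) ys
    ys≡ : ys ≡ xs ++ ys′
    ys≡ = commuting-prefix xs ys e xs≤ys
    ≤N′ : length xs + length ys′ ≤ N
    ≤N′ = s≤s⁻¹ (≤-trans (+-monoˡ-≤ _ 1≤)
            (subst (λ w → length xs + w ≤ suc N) (trans (cong length ys≡) (length-++ xs)) ≤N))
    e′ : xs ++ ys′ ≡ ys′ ++ xs
    e′ = ++-cancelˡ xs (xs ++ ys′) (ys′ ++ xs)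
           (trans (cong (xs ++_) (sym ys≡)) (trans e (trans (cong (_++ xs) ys≡) (++-assoc xs ys′ xs))))

length≥1⇒power≥1 : ∀ {xs : List X} n z → 1 ≤ length xs → xs ≡ power n z → 1 ≤ n
length≥1⇒power≥1 zero    z 1≤ refl = 1≤
length≥1⇒power≥1 (suc n) z _  _    = s≤s z≤n

rotation-fixed⇒proper-power : ∀ (xs : List X) d → 0 < d → d < length xs → rotate xs d ≡ xs →
                              ∃[ z ] ∃[ n ] (2 ≤ n × xs ≡ power n z)
rotation-fixed⇒proper-power xs d 0<d d<|xs| fixed =
  let z , m , n , take≡ , drop≡ = commute⇒CommonPower (length xs) (take d xs) (drop d xs) split-length commute
  in z , m + n ,
     +-mono-≤ (length≥1⇒power≥1 m z |take|≥1 take≡) (length≥1⇒power≥1 n z |drop|≥1 drop≡) ,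
     trans (sym (take++drop≡id d xs)) (trans (cong₂ _++_ take≡ drop≡) (sym (power-+ m n z)))
  where
  split-length : length (take d xs) + length (drop d xs) ≤ length xs
  split-length = ≤-reflexive (trans (sym (length-++ (take d xs))) (cong length (take++drop≡id d xs)))
  commute : take d xs ++ drop d xs ≡ drop d xs ++ take d xs
  commute = trans (take++drop≡id d xs) (sym fixed)
  |take|≥1 : 1 ≤ length (take d xs)
  |take|≥1 = subst (1 ≤_) (sym (trans (length-take d xs) (m≤n⇒m⊓n≡m (<⇒≤ d<|xs|)))) 0<d
  |drop|≥1 : 1 ≤ length (drop d xs)
  |drop|≥1 = subst (1 ≤_) (sym (length-drop d xs)) (m<n⇒0<n∸m d<|xs|)

coprime⇒rotations-distinct : ∀ xs → Coprime (length xs) (sum xs) →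
                             ∀ r d → 0 < d → r + d < length xs → rotate xs r ≢ rotate xs (r + d)
coprime⇒rotations-distinct xs coprime r d 0<d r+d< eq =
  let z , n , 2≤n , ys≡ = rotation-fixed⇒proper-power ys d 0<d d<|ys| fixed
  in <-irrefl (sym (coprime (∣length ys≡ , ∣sum ys≡))) 2≤n
  where
  ys : List ℕ
  ys = rotate xs r
  |ys| : length ys ≡ length xs
  |ys| = length-rotate xs r (≤-trans (m≤m+n r d) (<⇒≤ r+d<))
  d<|ys| : d < length ys
  d<|ys| = subst (d <_) (sym |ys|) (≤-trans (s≤s (m≤n+m d r)) r+d<)
  fixed : rotate ys d ≡ ys
  fixed = trans (rotate-rotate xs r d (<⇒≤ r+d<)) (sym eq)
  ∣length : ∀ {n z} → ys ≡ power n z → n ∣ length xs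
  ∣length {n} {z} ys≡ = divides (length z) (begin
    length xs          ≡⟨ |ys| ⟨
    length ys          ≡⟨ cong length ys≡ ⟩
    length (power n z) ≡⟨ length-power n z ⟩
    n * length z       ≡⟨ *-comm n (length z) ⟩
    length z * n       ∎)
    where open ≡-Reasoning
  ∣sum : ∀ {n z} → ys ≡ power n z → n ∣ sum xs
  ∣sum {n} {z} ys≡ = divides (sum z) (begin
    sum xs          ≡⟨ sum-rotate xs r ⟨
    sum ys          ≡⟨ cong sum ys≡ ⟩
    sum (power n z) ≡⟨ sum-power n z ⟩
    n * sum z       ≡⟨ *-comm n (sum z) ⟩
    sum z * n       ∎)
    where open ≡-Reasoning

coprime⇒rotation-offset-unique : ∀ xs → Coprime (length xs) (sum xs) →
  ∀ r r′ → r < length xs → r′ < length xs →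
  (∀ i → suc i < length xs → at (rotate xs r) i ≡ at (rotate xs r′) i) → r ≡ r′
coprime⇒rotation-offset-unique xs coprime r r′ r< r′< agree = by-cmp (<-cmp r r′)
  where
  |r|≡|xs| : length (rotate xs r) ≡ length xs
  |r|≡|xs| = length-rotate xs r (<⇒≤ r<)
  eq : rotate xs r ≡ rotate xs r′
  eq = ≡-from-init-sum _ _ (trans |r|≡|xs| (sym (length-rotate xs r′ (<⇒≤ r′<))))
         (trans (sum-rotate xs r) (sym (sum-rotate xs r′)))
         (λ i 2+i≤ → agree i (subst (suc i <_) |r|≡|xs| 2+i≤))
  distinct : ∀ {s s′} → s < s′ → s′ < length xs → rotate xs s ≢ rotate xs s′
  distinct {s} {s′} s<s′ s′< = subst (λ x → rotate xs s ≢ rotate xs x) (m+[n∸m]≡n (<⇒≤ s<s′))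
    (coprime⇒rotations-distinct xs coprime s (s′ ∸ s) (m<n⇒0<n∸m s<s′)
      (subst (_< length xs) (sym (m+[n∸m]≡n (<⇒≤ s<s′))) s′<))
  by-cmp : Tri (r < r′) (r ≡ r′) (r′ < r) → r ≡ r′
  by-cmp (tri< r<r′ _ _) = ⊥-elim (distinct r<r′ r′< eq)
  by-cmp (tri≈ _ r≡r′ _) = r≡r′
  by-cmp (tri> _ _ r′<r) = ⊥-elim (distinct r′<r r< (sym eq))

-- Standard words and continuants

AlmostCommute : List X → List X → Set
AlmostCommute xs ys =
  ∃[ u ] ∃[ c ] ∃[ d ] (c ≢ d × xs ++ ys ≡ u ++ c ∷ d ∷ [] × ys ++ xs ≡ u ++ d ∷ c ∷ [])

AlmostCommute-power-++ : ∀ n {xs ys : List X} → AlmostCommute xs ys → AlmostCommute (power n xs ++ ys) xs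
AlmostCommute-power-++ n {xs} {ys} (u , c , d , c≢d , xy≡ , yx≡) =
  power n xs ++ u , d , c , (λ d≡c → c≢d (sym d≡c)) , left , right
  where
  open ≡-Reasoning
  left : (power n xs ++ ys) ++ xs ≡ (power n xs ++ u) ++ d ∷ c ∷ []
  left = begin
    (power n xs ++ ys) ++ xs      ≡⟨ ++-assoc (power n xs) ys xs ⟩
    power n xs ++ (ys ++ xs)      ≡⟨ cong (power n xs ++_) yx≡ ⟩
    power n xs ++ (u ++ d ∷ c ∷ []) ≡⟨ ++-assoc (power n xs) u _ ⟨
    (power n xs ++ u) ++ d ∷ c ∷ [] ∎
  right : xs ++ (power n xs ++ ys) ≡ (power n xs ++ u) ++ c ∷ d ∷ []
  right = begin
    xs ++ (power n xs ++ ys)      ≡⟨ ++-assoc xs (power n xs) ys ⟨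
    (xs ++ power n xs) ++ ys      ≡⟨ cong (_++ ys) (power-comm n xs) ⟩
    (power n xs ++ xs) ++ ys      ≡⟨ ++-assoc (power n xs) xs ys ⟩
    power n xs ++ (xs ++ ys)      ≡⟨ cong (power n xs ++_) xy≡ ⟩
    power n xs ++ (u ++ c ∷ d ∷ []) ≡⟨ ++-assoc (power n xs) u _ ⟨
    (power n xs ++ u) ++ c ∷ d ∷ [] ∎

-- x v − y u = ±1, stated without subtraction.
Unimodular : ℕ × ℕ → ℕ × ℕ → Set
Unimodular (x , y) (u , v) = y * u + 1 ≡ x * v ⊎ x * v + 1 ≡ y * u

Unimodular-step : ∀ A {x y u v} → Unimodular (x , y) (u , v) → Unimodular (y , A * y + x) (v , A * v + u)
Unimodular-step A {x} {y} {u} {v} = swap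
  where
  open ≡-Reasoning
  [Ay+x]v : (A * y + x) * v ≡ A * y * v + x * v
  [Ay+x]v = *-distribʳ-+ v (A * y) x
  y[Av+u] : y * (A * v + u) ≡ A * y * v + y * u
  y[Av+u] = begin
    y * (A * v + u)     ≡⟨ *-distribˡ-+ y (A * v) u ⟩
    y * (A * v) + y * u ≡⟨ cong (_+ y * u) (*-assoc y A v) ⟨
    y * A * v + y * u   ≡⟨ cong (λ w → w * v + y * u) (*-comm y A) ⟩
    A * y * v + y * u   ∎
  shift : ∀ {m n} → m + 1 ≡ n → A * y * v + m + 1 ≡ A * y * v + n
  shift {m} e = trans (+-assoc (A * y * v) m 1) (cong (A * y * v +_) e)
  swap : Unimodular (x , y) (u , v) → Unimodular (y , A * y + x) (v , A * v + u)
  swap (inj₁ e) = inj₂ (trans (cong (_+ 1) y[Av+u]) (trans (shift e) (sym [Ay+x]v)))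
  swap (inj₂ e) = inj₁ (trans (cong (_+ 1) [Ay+x]v) (trans (shift e) (sym y[Av+u])))

Unimodular⇒Coprime : ∀ P Q → Unimodular P Q → Coprime (proj₂ Q) (proj₂ P)
Unimodular⇒Coprime (x , y) (u , v) (inj₁ e) {d} (d∣v , d∣y) =
  ∣1⇒≡1 (∣m+n∣m⇒∣n (subst (d ∣_) (sym e) (∣n⇒∣m*n x d∣v)) (∣m⇒∣m*n u d∣y))
Unimodular⇒Coprime (x , y) (u , v) (inj₂ e) {d} (d∣v , d∣y) =
  ∣1⇒≡1 (∣m+n∣m⇒∣n (subst (d ∣_) (sym e) (∣m⇒∣m*n u d∣y)) (∣n⇒∣m*n x d∣v))

sum-replicate-0 : ∀ n → sum (replicate n 0) ≡ 0
sum-replicate-0 zero    = refl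
sum-replicate-0 (suc n) = sum-replicate-0 n

module _ (a : ℕ → ℕ) where

  M-step : ∀ k → M a (2 + k) ≡ power (a (2 + k)) (M a (suc k)) ++ M a k
  M-step zero    = refl
  M-step (suc k) = refl

  sum-M : ∀ k → sum (M a k) ≡ p a k
  sum-M zero          = refl
  sum-M (suc zero)    = begin
    sum (replicate (a 1 ∸ 1) 0 ++ 1 ∷ [])  ≡⟨ sum-++ (replicate (a 1 ∸ 1) 0) (1 ∷ []) ⟩
    sum (replicate (a 1 ∸ 1) 0) + 1         ≡⟨ cong (_+ 1) (sum-replicate-0 (a 1 ∸ 1)) ⟩
    1                                       ≡⟨ cong (_+ 1) (*-zeroʳ (a 1)) ⟨
    a 1 * 0 + 1                             ∎
    where open ≡-Reasoning
  sum-M (suc (suc k)) = begin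
    sum (M a (2 + k))                         ≡⟨ cong sum (M-step k) ⟩
    sum (power A (M a (suc k)) ++ M a k)      ≡⟨ sum-++ (power A (M a (suc k))) (M a k) ⟩
    sum (power A (M a (suc k))) + sum (M a k) ≡⟨ cong (_+ sum (M a k)) (sum-power A (M a (suc k))) ⟩
    A * sum (M a (suc k)) + sum (M a k)       ≡⟨ cong₂ (λ x y → A * x + y) (sum-M (suc k)) (sum-M k) ⟩
    A * p a (suc k) + p a k                   ∎
    where
    open ≡-Reasoning
    A : ℕ
    A = a (2 + k)

  M-AlmostCommute : ∀ k → AlmostCommute (M a (suc k)) (M a k)
  M-AlmostCommute zero    = replicate n 0 , 1 , 0 , (λ ()) , ++-assoc (replicate n 0) (1 ∷ []) (0 ∷ []) ,
    trans (cong (_++ 1 ∷ []) (∷-replicate n)) (++-assoc (replicate n 0) (0 ∷ []) (1 ∷ []))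
    where
    n : ℕ
    n = a 1 ∸ 1
    ∷-replicate : ∀ n → 0 ∷ replicate n 0 ≡ replicate n 0 ++ 0 ∷ []
    ∷-replicate zero    = refl
    ∷-replicate (suc n) = cong (0 ∷_) (∷-replicate n)
  M-AlmostCommute (suc k) = subst (λ w → AlmostCommute w (M a (suc k))) (sym (M-step k))
    (AlmostCommute-power-++ (a (2 + k)) (M-AlmostCommute k))

  q₁≡a₁ : q a 1 ≡ a 1
  q₁≡a₁ = trans (+-identityʳ _) (*-identityʳ (a 1))

  pq-Unimodular : ∀ k → Unimodular (pp a k) (qp a k)
  pq-Unimodular zero    = inj₁ refl
  pq-Unimodular (suc k) = Unimodular-step (a (suc k)) (pq-Unimodular k)

  Coprime-q-p : ∀ k → Coprime (q a k) (p a k)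
  Coprime-q-p k = Unimodular⇒Coprime (pp a k) (qp a k) (pq-Unimodular k)

  module _ (pos : PositiveDigits a) where

    length-M : ∀ k → length (M a k) ≡ q a k
    length-M zero          = refl
    length-M (suc zero)    = begin
      length (replicate (a 1 ∸ 1) 0 ++ 1 ∷ [])  ≡⟨ length-++ (replicate (a 1 ∸ 1) 0) ⟩
      length (replicate (a 1 ∸ 1) 0) + 1         ≡⟨ cong (_+ 1) (length-replicate (a 1 ∸ 1)) ⟩
      (a 1 ∸ 1) + 1                              ≡⟨ m∸n+n≡m (pos 1 (s≤s z≤n)) ⟩
      a 1                                        ≡⟨ q₁≡a₁ ⟨
      a 1 * 1 + 0                                ∎
      where open ≡-Reasoning
    length-M (suc (suc k)) = begin
      length (M a (2 + k))                            ≡⟨ cong length (M-step k) ⟩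
      length (power A (M a (suc k)) ++ M a k)         ≡⟨ length-++ (power A (M a (suc k))) ⟩
      length (power A (M a (suc k))) + length (M a k) ≡⟨ cong (_+ length (M a k)) (length-power A (M a (suc k))) ⟩
      A * length (M a (suc k)) + length (M a k)       ≡⟨ cong₂ (λ x y → A * x + y) (length-M (suc k)) (length-M k) ⟩
      A * q a (suc k) + q a k                         ∎
      where
      open ≡-Reasoning
      A : ℕ
      A = a (2 + k)

    q≥1 : ∀ k → 1 ≤ q a k
    q≥1 zero          = s≤s z≤n
    q≥1 (suc zero)    = subst (1 ≤_) (sym q₁≡a₁) (pos 1 (s≤s z≤n))
    q≥1 (suc (suc k)) = ≤-trans (q≥1 k) (m≤n+m (q a k) _)

    q-mono : ∀ k → q a k ≤ q a (suc k)
    q-mono zero    = q≥1 1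
    q-mono (suc k) = ≤-trans (m≤m*n (q a (suc k)) (a (2 + k)) {{>-nonZero (pos (2 + k) (s≤s z≤n))}})
                       (≤-trans (≤-reflexive (*-comm (q a (suc k)) _)) (m≤m+n _ (q a k)))

-- Rotations of m^A m′ compared with rotations of m

module AlmostCommutingPair
  (m m′ u : List ℕ) (c d : ℕ) (c≢d : c ≢ d)
  (mm′≡ucd : m ++ m′ ≡ u ++ c ∷ d ∷ []) (m′m≡udc : m′ ++ m ≡ u ++ d ∷ c ∷ [])
  (1≤ℓ′ : 1 ≤ length m′) (ℓ′≤ℓ : length m′ ≤ length m)
  where

  open ≡-Reasoning

  ℓ ℓ′ n : ℕ
  ℓ  = length m
  ℓ′ = length m′
  n  = length u

  ℓ+ℓ′≡n+2 : ℓ + ℓ′ ≡ n + 2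
  ℓ+ℓ′≡n+2 = trans (sym (length-++ m)) (trans (cong length mm′≡ucd) (length-++ u))

  ≤n : ∀ {x} → 2 + x ≤ ℓ + ℓ′ → x ≤ n
  ≤n {x} h = s≤s⁻¹ (s≤s⁻¹ (subst (2 + x ≤_) (trans ℓ+ℓ′≡n+2 (+-comm n 2)) h))

  offset-bound : ∀ {r i} → r < ℓ′ → i < ℓ → r + i ≤ n
  offset-bound {r} {i} r<ℓ′ i<ℓ = ≤n (subst (_≤ ℓ + ℓ′) (trans (+-suc (suc i) r) (cong (2 +_) (+-comm i r)))
                                      (+-mono-≤ i<ℓ r<ℓ′))

  1≤ℓ : 1 ≤ ℓ
  1≤ℓ = ≤-trans 1≤ℓ′ ℓ′≤ℓ

  ℓ∸1<ℓ : ℓ ∸ 1 < ℓ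
  ℓ∸1<ℓ = ∸-monoʳ-< z<s 1≤ℓ

  ℓ<ℓ+ℓ′ : ℓ < ℓ + ℓ′
  ℓ<ℓ+ℓ′ = subst (_≤ ℓ + ℓ′) (+-comm ℓ 1) (+-monoʳ-≤ ℓ 1≤ℓ′)

  mm′≈m′m : ∀ z → z < n → at (m ++ m′) z ≡ at (m′ ++ m) z
  mm′≈m′m z z<n = begin
    at (m ++ m′) z         ≡⟨ cong (λ w → at w z) mm′≡ucd ⟩
    at (u ++ c ∷ d ∷ []) z ≡⟨ at-++ˡ u _ z z<n ⟩
    at u z                 ≡⟨ at-++ˡ u _ z z<n ⟨
    at (u ++ d ∷ c ∷ []) z ≡⟨ cong (λ w → at w z) m′m≡udc ⟨
    at (m′ ++ m) z         ∎

  mm′≉m′m : at (m ++ m′) n ≢ at (m′ ++ m) n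
  mm′≉m′m eq = c≢d (begin
    c                      ≡⟨ at-++-length u c (d ∷ []) ⟨
    at (u ++ c ∷ d ∷ []) n ≡⟨ cong (λ w → at w n) mm′≡ucd ⟨
    at (m ++ m′) n         ≡⟨ eq ⟩
    at (m′ ++ m) n         ≡⟨ cong (λ w → at w n) m′m≡udc ⟩
    at (u ++ d ∷ c ∷ []) n ≡⟨ at-++-length u d (c ∷ []) ⟩
    d                      ∎)

  mm≈mm′ : ∀ z → z ≤ n → at (m ++ m) z ≡ at (m ++ m′) z
  mm≈mm′ z z≤|u| with <⊎≡+ ℓ z
  ... | inj₁ z<ℓ = trans (at-++ˡ m m z z<ℓ) (sym (at-++ˡ m m′ z z<ℓ))
  ... | inj₂ (y , refl) = begin
    at (m ++ m) (ℓ + y)   ≡⟨ at-++ʳ m m y ⟩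
    at m y                ≡⟨ at-++ˡ m m′ y y<ℓ ⟨
    at (m ++ m′) y        ≡⟨ mm′≈m′m y (<-≤-trans y<ℓ (≤-trans (m≤m+n ℓ y) z≤|u|)) ⟩
    at (m′ ++ m) y        ≡⟨ at-++ˡ m′ m y y<ℓ′ ⟩
    at m′ y               ≡⟨ at-++ʳ m m′ y ⟨
    at (m ++ m′) (ℓ + y)  ∎
    where
    2+y≤ℓ′ : 2 + y ≤ ℓ′
    2+y≤ℓ′ = +-cancelˡ-≤ ℓ _ _
      (subst₂ _≤_ (trans (+-assoc ℓ y 2) (cong (ℓ +_) (+-comm y 2))) (sym ℓ+ℓ′≡n+2) (+-monoˡ-≤ 2 z≤|u|))
    y<ℓ′ : y < ℓ′
    y<ℓ′ = ≤-trans (n≤1+n (suc y)) 2+y≤ℓ′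
    y<ℓ : y < ℓ
    y<ℓ = <-≤-trans y<ℓ′ ℓ′≤ℓ

  StartsLike-m : List ℕ → Set
  StartsLike-m ys = ∀ y → suc y < ℓ → at ys y ≡ at m y

  m++-StartsLike-m : ∀ ys → StartsLike-m (m ++ ys)
  m++-StartsLike-m ys y 2+y≤ℓ = at-++ˡ m ys y (≤-trans (n≤1+n (suc y)) 2+y≤ℓ)

  -- m′ m agrees with m m′ before position |u|, and |u| ≥ ℓ − 1.
  m′++m++-StartsLike-m : ∀ ys → StartsLike-m (m′ ++ (m ++ ys))
  m′++m++-StartsLike-m ys y 2+y≤ℓ = begin
    at (m′ ++ (m ++ ys)) y ≡⟨ cong (λ w → at w y) (++-assoc m′ m ys) ⟨
    at ((m′ ++ m) ++ ys) y ≡⟨ at-++ˡ (m′ ++ m) ys y y<|m′m| ⟩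
    at (m′ ++ m) y         ≡⟨ mm′≈m′m y y<n ⟨
    at (m ++ m′) y         ≡⟨ at-++ˡ m m′ y y<ℓ ⟩
    at m y                 ∎
    where
    y<ℓ : y < ℓ
    y<ℓ = ≤-trans (n≤1+n (suc y)) 2+y≤ℓ
    y<|m′m| : y < length (m′ ++ m)
    y<|m′m| = subst (y <_) (sym (length-++ m′)) (<-≤-trans y<ℓ (m≤n+m ℓ ℓ′))
    y<n : y < n
    y<n = ≤n (≤-trans (s≤s 2+y≤ℓ) ℓ<ℓ+ℓ′)

  m++StartsLike-m : ∀ ys → StartsLike-m ys → ∀ x → suc x < ℓ + ℓ → at (m ++ ys) x ≡ at (m ++ m) x
  m++StartsLike-m ys like x 2+x≤2ℓ with <⊎≡+ ℓ x
  ... | inj₁ x<ℓ = trans (at-++ˡ m ys x x<ℓ) (sym (at-++ˡ m m x x<ℓ))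
  ... | inj₂ (y , refl) = trans (at-++ʳ m ys y) (trans (like y 2+y≤ℓ) (sym (at-++ʳ m m y)))
    where
    2+y≤ℓ : suc y < ℓ
    2+y≤ℓ = +-cancelˡ-< ℓ (suc y) ℓ (subst (_< ℓ + ℓ) (sym (+-suc ℓ y)) 2+x≤2ℓ)

  Λ : ℕ → List ℕ
  Λ A = power A m ++ m′

  length-Λ : ∀ A → length (Λ A) ≡ A * ℓ + ℓ′
  length-Λ A = trans (length-++ (power A m)) (cong (_+ ℓ′) (length-power A m))

  ℓ≤|Λ| : ∀ {A} → 1 ≤ A → ℓ ≤ length (Λ A)
  ℓ≤|Λ| {A} 1≤A = subst (ℓ ≤_) (sym (length-Λ A))
    (≤-trans (subst (_≤ A * ℓ) (*-identityˡ ℓ) (*-monoˡ-≤ ℓ 1≤A)) (m≤m+n (A * ℓ) ℓ′))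

  Λ≡m++ : ∀ A → 1 ≤ A → Λ A ≡ m ++ Λ (A ∸ 1)
  Λ≡m++ (suc A) _ = ++-assoc m (power A m) m′

  Λ++Λ≡ : ∀ A → Λ A ++ Λ A ≡ power A m ++ (m′ ++ Λ A)
  Λ++Λ≡ A = ++-assoc (power A m) m′ (Λ A)

  window-power : ∀ A J → J < A → ∀ x → suc x < ℓ + ℓ → at (Λ A ++ Λ A) (J * ℓ + x) ≡ at (m ++ m) x
  window-power A J J<A x 2+x≤2ℓ = begin
    at (Λ A ++ Λ A) (J * ℓ + x)                  ≡⟨ cong (λ w → at w (J * ℓ + x)) Λ++Λ≡power-J ⟩
    at (power J m ++ (m ++ rest)) (J * ℓ + x)    ≡⟨ at-power-++ J m (m ++ rest) x ⟩
    at (m ++ rest) x                             ≡⟨ m++StartsLike-m rest (rest-like e) x 2+x≤2ℓ ⟩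
    at (m ++ m) x                                ∎
    where
    e : ℕ
    e = A ∸ suc J
    rest : List ℕ
    rest = power e m ++ (m′ ++ Λ A)
    A≡J+1+e : A ≡ J + suc e
    A≡J+1+e = trans (sym (m+[n∸m]≡n J<A)) (sym (+-suc J e))
    Λ++Λ≡power-J : Λ A ++ Λ A ≡ power J m ++ (m ++ rest)
    Λ++Λ≡power-J = begin
      Λ A ++ Λ A                                 ≡⟨ Λ++Λ≡ A ⟩
      power A m ++ (m′ ++ Λ A)                   ≡⟨ cong (λ k → power k m ++ (m′ ++ Λ A)) A≡J+1+e ⟩
      power (J + suc e) m ++ (m′ ++ Λ A)         ≡⟨ cong (_++ (m′ ++ Λ A)) (power-+ J (suc e) m) ⟩
      (power J m ++ power (suc e) m) ++ (m′ ++ Λ A) ≡⟨ ++-assoc (power J m) (power (suc e) m) _ ⟩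
      power J m ++ ((m ++ power e m) ++ (m′ ++ Λ A)) ≡⟨ cong (power J m ++_) (++-assoc m (power e m) _) ⟩
      power J m ++ (m ++ rest)                   ∎
    rest-like : ∀ e′ → StartsLike-m (power e′ m ++ (m′ ++ Λ A))
    rest-like zero     = subst (λ w → StartsLike-m (m′ ++ w)) (sym (Λ≡m++ A (≤-trans (s≤s z≤n) J<A)))
                             (m′++m++-StartsLike-m (Λ (A ∸ 1)))
    rest-like (suc e′) = subst StartsLike-m (sym (++-assoc m (power e′ m) _)) (m++-StartsLike-m _)

  window-tail : ∀ A → 1 ≤ A → ∀ z → z ≤ n → at (Λ A ++ Λ A) (A * ℓ + z) ≡ at (m′ ++ m) z
  window-tail A 1≤A z z≤|u| = begin
    at (Λ A ++ Λ A) (A * ℓ + z)                ≡⟨ cong (λ w → at w (A * ℓ + z)) (Λ++Λ≡ A) ⟩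
    at (power A m ++ (m′ ++ Λ A)) (A * ℓ + z)  ≡⟨ at-power-++ A m (m′ ++ Λ A) z ⟩
    at (m′ ++ Λ A) z                           ≡⟨ cong (λ w → at (m′ ++ w) z) (Λ≡m++ A 1≤A) ⟩
    at (m′ ++ (m ++ Λ (A ∸ 1))) z              ≡⟨ cong (λ w → at w z) (++-assoc m′ m _) ⟨
    at ((m′ ++ m) ++ Λ (A ∸ 1)) z              ≡⟨ at-++ˡ (m′ ++ m) _ z z<|m′m| ⟩
    at (m′ ++ m) z                             ∎
    where
    z<|m′m| : z < length (m′ ++ m)
    z<|m′m| = subst (z <_) (sym (trans (cong length m′m≡udc) (length-++ u)))
                (subst (suc z ≤_) (+-comm 2 n) (s≤s (m≤n⇒m≤1+n z≤|u|)))

  quotient-bound : ∀ A J r → J * ℓ + r < length (Λ A) → J ≤ A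
  quotient-bound A J r t< = s≤s⁻¹ (*-cancelʳ-< ℓ J (suc A)
    (≤-<-trans (m≤m+n (J * ℓ) r) (<-≤-trans t< |Λ|≤[1+A]ℓ)))
    where
    |Λ|≤[1+A]ℓ : length (Λ A) ≤ suc A * ℓ
    |Λ|≤[1+A]ℓ = subst₂ _≤_ (sym (length-Λ A)) (+-comm (A * ℓ) ℓ) (+-monoʳ-≤ (A * ℓ) ℓ′≤ℓ)

  |Λ|∸1≡ : ∀ A → length (Λ A) ∸ 1 ≡ A * ℓ + (ℓ′ ∸ 1)
  |Λ|∸1≡ A = trans (cong (_∸ 1) (length-Λ A)) (+-∸-assoc (A * ℓ) 1≤ℓ′)

  tail-remainder-bound : ∀ A r → A * ℓ + r < length (Λ A) → r < ℓ′
  tail-remainder-bound A r t< = +-cancelˡ-< (A * ℓ) r ℓ′ (subst (A * ℓ + r <_) (length-Λ A) t<)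

  rotate-Λ≈rotate-m : ∀ A → 1 ≤ A → ∀ J r → r < ℓ → J * ℓ + r < length (Λ A) →
                      ∀ i → i < ℓ → (J ≡ A → r + i < n) →
                      at (rotate (Λ A) (J * ℓ + r)) i ≡ at (rotate m r) i
  rotate-Λ≈rotate-m A 1≤A J r r<ℓ t< i i<ℓ tail-condition = begin
    at (rotate (Λ A) (J * ℓ + r)) i     ≡⟨ at-rotate (Λ A) (J * ℓ + r) i (<⇒≤ t<) (<-≤-trans i<ℓ (ℓ≤|Λ| 1≤A)) ⟩
    at (Λ A ++ Λ A) (J * ℓ + r + i)     ≡⟨ cong (at (Λ A ++ Λ A)) (+-assoc (J * ℓ) r i) ⟩
    at (Λ A ++ Λ A) (J * ℓ + (r + i))   ≡⟨ window (J <? A) ⟩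
    at (m ++ m) (r + i)                 ≡⟨ at-rotate m r i (<⇒≤ r<ℓ) i<ℓ ⟨
    at (rotate m r) i                   ∎
    where
    window : Dec (J < A) → at (Λ A ++ Λ A) (J * ℓ + (r + i)) ≡ at (m ++ m) (r + i)
    window (yes J<A) = window-power A J J<A (r + i)
                         (subst (_≤ ℓ + ℓ) (+-suc (suc r) i) (+-mono-≤ r<ℓ i<ℓ))
    window (no  J≮A) with ≤-antisym (quotient-bound A J r t<) (≮⇒≥ J≮A)
    ... | refl = begin
      at (Λ A ++ Λ A) (A * ℓ + (r + i))  ≡⟨ window-tail A 1≤A (r + i) (<⇒≤ r+i<n) ⟩
      at (m′ ++ m) (r + i)               ≡⟨ mm′≈m′m (r + i) r+i<n ⟨
      at (m ++ m′) (r + i)               ≡⟨ mm≈mm′ (r + i) (<⇒≤ r+i<n) ⟨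
      at (m ++ m) (r + i)                ∎
      where
      r+i<n : r + i < n
      r+i<n = tail-condition refl

  rotate-Λ≉rotate-m : ∀ A → 1 ≤ A →
    at (rotate (Λ A) (A * ℓ + (ℓ′ ∸ 1))) (ℓ ∸ 1) ≢ at (rotate m (ℓ′ ∸ 1)) (ℓ ∸ 1)
  rotate-Λ≉rotate-m A 1≤A eq = mm′≉m′m (begin
    at (m ++ m′) n                                  ≡⟨ mm≈mm′ n ≤-refl ⟨
    at (m ++ m) n                                   ≡⟨ cong (at (m ++ m)) r+i≡n ⟨
    at (m ++ m) (r + i)                             ≡⟨ at-rotate m r i (≤-trans (m∸n≤m ℓ′ 1) ℓ′≤ℓ) i<ℓ ⟨
    at (rotate m r) i                               ≡⟨ eq ⟨
    at (rotate (Λ A) (A * ℓ + r)) i                 ≡⟨ at-rotate (Λ A) (A * ℓ + r) i t≤ (<-≤-trans i<ℓ (ℓ≤|Λ| 1≤A)) ⟩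
    at (Λ A ++ Λ A) (A * ℓ + r + i)                 ≡⟨ cong (at (Λ A ++ Λ A)) (trans (+-assoc (A * ℓ) r i) (cong (A * ℓ +_) r+i≡n)) ⟩
    at (Λ A ++ Λ A) (A * ℓ + n)                     ≡⟨ window-tail A 1≤A n ≤-refl ⟩
    at (m′ ++ m) n                                  ∎)
    where
    r i : ℕ
    r = ℓ′ ∸ 1
    i = ℓ ∸ 1
    i<ℓ : i < ℓ
    i<ℓ = ℓ∸1<ℓ
    r+i≡n : r + i ≡ n
    r+i≡n = +-cancelʳ-≡ 2 (r + i) n (begin
      r + i + 2              ≡⟨ two-units r i ⟩
      (i + 1) + (r + 1)      ≡⟨ cong₂ _+_ (m∸n+n≡m 1≤ℓ) (m∸n+n≡m 1≤ℓ′) ⟩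
      ℓ + ℓ′                 ≡⟨ ℓ+ℓ′≡n+2 ⟩
      n + 2                  ∎)
      where
      two-units : ∀ x y → x + y + 2 ≡ (y + 1) + (x + 1)
      two-units = solve-∀
    t≤ : A * ℓ + r ≤ length (Λ A)
    t≤ = subst (A * ℓ + r ≤_) (sym (length-Λ A)) (+-monoʳ-≤ (A * ℓ) (m∸n≤m ℓ′ 1))

  module _ (A : ℕ) (1≤A : 1 ≤ A) (coprime : Coprime ℓ (sum m))
           (t r : ℕ) (t< : t < length (Λ A)) (r<ℓ : r < ℓ)
           (agree : ∀ i → suc i < ℓ → at (rotate m r) i ≡ at (rotate (Λ A) t) i) where

    private
      division : ∃[ J ] ∃[ r₀ ] (r₀ < ℓ × t ≡ J * ℓ + r₀)
      division = divMod t ℓ 1≤ℓ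

      J r₀ : ℕ
      J  = proj₁ division
      r₀ = proj₁ (proj₂ division)

      r₀<ℓ : r₀ < ℓ
      r₀<ℓ = proj₁ (proj₂ (proj₂ division))

      t≡ : t ≡ J * ℓ + r₀
      t≡ = proj₂ (proj₂ (proj₂ division))

      Jℓ+r₀< : J * ℓ + r₀ < length (Λ A)
      Jℓ+r₀< = subst (_< length (Λ A)) t≡ t<

      rotate-Λ≈ : ∀ i → i < ℓ → (J ≡ A → r₀ + i < n) → at (rotate (Λ A) t) i ≡ at (rotate m r₀) i
      rotate-Λ≈ i i<ℓ cond = trans (cong (λ x → at (rotate (Λ A) x) i) t≡)
                                   (rotate-Λ≈rotate-m A 1≤A J r₀ r₀<ℓ Jℓ+r₀< i i<ℓ cond)

      r≡r₀ : r ≡ r₀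
      r≡r₀ = coprime⇒rotation-offset-unique m coprime r r₀ r<ℓ r₀<ℓ λ i 2+i≤ℓ →
        trans (agree i 2+i≤ℓ) (rotate-Λ≈ i (<-trans (n<1+n i) 2+i≤ℓ) λ J≡A →
          subst (_≤ n) (+-suc r₀ i) (offset-bound (tail-remainder-bound′ J≡A) 2+i≤ℓ))
        where
        tail-remainder-bound′ : J ≡ A → r₀ < ℓ′
        tail-remainder-bound′ refl = tail-remainder-bound A r₀ Jℓ+r₀<

    rotate-Λ-offset : ∃[ j ] t ≡ j * ℓ + r
    rotate-Λ-offset = J , trans t≡ (cong (J * ℓ +_) (sym r≡r₀))

    rotate-Λ-prefix : t ≢ length (Λ A) ∸ 1 → Prefix _≡_ (rotate m r) (rotate (Λ A) t)
    rotate-Λ-prefix t≢ = at⇒Prefix (rotate m r) (rotate (Λ A) t)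
      (subst₂ _≤_ (sym (length-rotate m r (<⇒≤ r<ℓ))) (sym (length-rotate (Λ A) t (<⇒≤ t<))) (ℓ≤|Λ| 1≤A))
      λ i i< → let i<ℓ = subst (i <_) (length-rotate m r (<⇒≤ r<ℓ)) i< in
        trans (cong (λ x → at (rotate m x) i) r≡r₀) (sym (rotate-Λ≈ i i<ℓ (not-last i<ℓ)))
      where
      not-last : ∀ {i} → i < ℓ → J ≡ A → r₀ + i < n
      not-last {i} i<ℓ refl = offset-bound (≤∧≢⇒< r₀<ℓ′ (λ 1+r₀≡ℓ′ → t≢ (begin
        t                       ≡⟨ t≡ ⟩
        J * ℓ + r₀              ≡⟨ cong (λ x → J * ℓ + (x ∸ 1)) 1+r₀≡ℓ′ ⟩
        J * ℓ + (ℓ′ ∸ 1)        ≡⟨ |Λ|∸1≡ A ⟨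
        length (Λ A) ∸ 1        ∎))) i<ℓ
        where
        r₀<ℓ′ : r₀ < ℓ′
        r₀<ℓ′ = tail-remainder-bound A r₀ Jℓ+r₀<

    rotate-Λ-¬prefix : t ≡ length (Λ A) ∸ 1 → ¬ Prefix _≡_ (rotate m r) (rotate (Λ A) t)
    rotate-Λ-¬prefix t≡last P = rotate-Λ≉rotate-m A 1≤A (sym
      (subst₂ (λ x y → at (rotate m x) (ℓ ∸ 1) ≡ at (rotate (Λ A) y) (ℓ ∸ 1)) r≡ℓ′∸1 t≡Aℓ+ℓ′∸1
        (Prefix⇒at P (ℓ ∸ 1) (subst (ℓ ∸ 1 <_) (sym (length-rotate m r (<⇒≤ r<ℓ))) ℓ∸1<ℓ))))
      where
      t≡Aℓ+ℓ′∸1 : t ≡ A * ℓ + (ℓ′ ∸ 1)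
      t≡Aℓ+ℓ′∸1 = trans t≡last (|Λ|∸1≡ A)
      r≡ℓ′∸1 : r ≡ ℓ′ ∸ 1
      r≡ℓ′∸1 = trans r≡r₀ (proj₂ (divMod-unique J A r₀ (ℓ′ ∸ 1) r₀<ℓ (<-≤-trans (∸-monoʳ-< z<s 1≤ℓ′) ℓ′≤ℓ)
                                    (trans (sym t≡) t≡Aℓ+ℓ′∸1)))

natℚ-injective : ∀ {x y} → natℚ x ≡ natℚ y → x ≡ y
natℚ-injective {x} {y} e with ℚP./-injective-≃ (mkℚᵘ (ℤ.+ x) 0) (mkℚᵘ (ℤ.+ y) 0) e
... | *≡* h = ℤP.+-injective (trans (sym (ℤP.*-identityʳ (ℤ.+ x))) (trans h (ℤP.*-identityʳ (ℤ.+ y))))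

divℚ-difference : ∀ j x n → 1 ≤ n → divℚ (ℤ.+ (j * n + x) ℤ.- ℤ.+ x) n ≡ natℚ j
divℚ-difference j x (suc n) _ = trans (cong (λ z → divℚ z (suc n)) [y+x]-x≡y)
  (ℚP.fromℚᵘ-cong {mkℚᵘ (ℤ.+ y) n} {mkℚᵘ (ℤ.+ j) 0}
    (*≡* (trans (ℤP.*-identityʳ (ℤ.+ y)) (ℤP.pos-* j (suc n)))))
  where
  open ≡-Reasoning
  y : ℕ
  y = j * suc n
  [y+x]-x≡y : ℤ.+ (y + x) ℤ.- ℤ.+ x ≡ ℤ.+ y
  [y+x]-x≡y = begin
    ℤ.+ (y + x) ℤ.- ℤ.+ x             ≡⟨ cong (ℤ._- ℤ.+ x) (ℤP.pos-+ y x) ⟩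
    (ℤ.+ y ℤ.+ ℤ.+ x) ℤ.- ℤ.+ x       ≡⟨ ℤP.+-assoc (ℤ.+ y) (ℤ.+ x) (ℤ.- ℤ.+ x) ⟩
    ℤ.+ y ℤ.+ (ℤ.+ x ℤ.- ℤ.+ x)       ≡⟨ cong (ℤ._+_ (ℤ.+ y)) (ℤP.+-inverseʳ (ℤ.+ x)) ⟩
    ℤ.+ y ℤ.+ ℤ.0ℤ                    ≡⟨ ℤP.+-identityʳ (ℤ.+ y) ⟩
    ℤ.+ y                             ∎

isOdd-2+ : ∀ {n} → isOdd n → isOdd (2 + n)
isOdd-2+ (k , refl) = suc k , cong (2 +_) (sym (+-suc k (k + 0)))

isEven-2+ : ∀ {n} → isEven n → isEven (2 + n)
isEven-2+ (k , refl) = suc k , cong suc (sym (+-suc k (k + 0)))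

isOdd-2+⁻ : ∀ {n} → isOdd (2 + n) → isOdd n
isOdd-2+⁻ (suc k , e) = k , suc-injective (suc-injective (trans e (cong (2 +_) (+-suc k (k + 0)))))

isEven-2+⁻ : ∀ {n} → isEven (2 + n) → isEven n
isEven-2+⁻ (suc k , e) = k , suc-injective (suc-injective (trans e (cong suc (+-suc k (k + 0)))))

isOdd⇒isEven-suc : ∀ {n} → isOdd n → isEven (suc n)
isOdd⇒isEven-suc (k , refl) = suc k , cong suc (sym (+-suc k (k + 0)))

isEven⇒isOdd-suc : ∀ {n} → isEven n → isOdd (suc n)
isEven⇒isOdd-suc (k , e) = k , cong suc e

¬isOdd∧isEven : ∀ n → isOdd n → ¬ isEven n
¬isOdd∧isEven zero          (_ , ()) _
¬isOdd∧isEven (suc zero)    _        (zero , ())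
¬isOdd∧isEven (suc zero)    _        (suc k , e) = 0≢1+n (trans (suc-injective e) (+-suc k (k + 0)))
¬isOdd∧isEven (suc (suc n)) o        e = ¬isOdd∧isEven n (isOdd-2+⁻ o) (isEven-2+⁻ e)

isOdd⊎isEven : ∀ n → isOdd n ⊎ isEven n
isOdd⊎isEven zero          = inj₂ (0 , refl)
isOdd⊎isEven (suc zero)    = inj₁ (0 , refl)
isOdd⊎isEven (suc (suc n)) with isOdd⊎isEven n
... | inj₁ o = inj₁ (isOdd-2+ o)
... | inj₂ e = inj₂ (isEven-2+ e)

≤3+⇒ : ∀ {i k} → i ≤ 3 + k → i ≤ suc k ⊎ i ≡ 2 + k ⊎ i ≡ 3 + k
≤3+⇒ i≤ with m≤n⇒m<n∨m≡n i≤
... | inj₂ i≡ = inj₂ (inj₂ i≡)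
... | inj₁ (s≤s i≤2+k) with m≤n⇒m<n∨m≡n i≤2+k
...   | inj₁ (s≤s i≤1+k) = inj₁ i≤1+k
...   | inj₂ i≡          = inj₂ (inj₁ i≡)

Pattern : (ℕ → ℕ) → (ℕ → ℚ) → (ℕ → Set) → (ℕ → Set) → ℕ → ℕ → Set
Pattern a β Z D lo k = ∀ i → lo ≤ i → i ≤ suc k → (Z i → β i ≡ natℚ 0) × (D i → β i ≡ natℚ (a i))

Pattern-2+ : ∀ {a β Z D lo k} → lo ≤ 2 + k → Z (2 + k) → ¬ D (2 + k) → D (3 + k) → ¬ Z (3 + k) →
  Pattern a β Z D lo (2 + k) ⇔ (Pattern a β Z D lo k × β (2 + k) ≡ natℚ 0 × β (3 + k) ≡ natℚ (a (3 + k)))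
Pattern-2+ {a} {β} {Z} {D} {lo} {k} lo≤ z₂ ¬d₂ d₃ ¬z₃ = mk⇔
  (λ P → (λ i lo≤i i≤ → P i lo≤i (≤-trans i≤ (m≤n+m (suc k) 2))) ,
         proj₁ (P (2 + k) lo≤ (n≤1+n _)) z₂ ,
         proj₂ (P (3 + k) (≤-trans lo≤ (n≤1+n _)) ≤-refl) d₃)
  (λ (P , e₂ , e₃) i lo≤i i≤ → extend P e₂ e₃ i lo≤i (≤3+⇒ i≤))
  where
  extend : Pattern a β Z D lo k → β (2 + k) ≡ natℚ 0 → β (3 + k) ≡ natℚ (a (3 + k)) →
           ∀ i → lo ≤ i → i ≤ suc k ⊎ i ≡ 2 + k ⊎ i ≡ 3 + k →
           (Z i → β i ≡ natℚ 0) × (D i → β i ≡ natℚ (a i))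
  extend P _  _  i lo≤i (inj₁ i≤)          = P i lo≤i i≤
  extend _ e₂ _  _ _    (inj₂ (inj₁ refl)) = (λ _ → e₂) , (λ d → ⊥-elim (¬d₂ d))
  extend _ _  e₃ _ _    (inj₂ (inj₂ refl)) = (λ z → ⊥-elim (¬z₃ z)) , (λ _ → e₃)

module _ {a t : ℕ → ℕ} where

  ExceptionalTuple-odd : ∀ {k} → isOdd k → ExceptionalTuple a t k ⇔ Pattern a (b a t) isOdd isEven 1 k
  ExceptionalTuple-odd {k} o =
    mk⇔ (λ E → proj₁ E o) (λ P → (λ _ → P) , (λ e → ⊥-elim (¬isOdd∧isEven k o e)))

  ExceptionalTuple-even : ∀ {k} → isEven k →
    ExceptionalTuple a t k ⇔ (b a t 1 ≡ natℚ (a 1 ∸ 1) × Pattern a (b a t) isEven isOdd 2 k)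
  ExceptionalTuple-even {k} e =
    mk⇔ (λ E → proj₂ E e) (λ P → (λ o → ⊥-elim (¬isOdd∧isEven k o e)) , (λ _ → P))

  ExceptionalTuple-0 : ExceptionalTuple a t 0 ⇔ b a t 1 ≡ natℚ (a 1 ∸ 1)
  ExceptionalTuple-0 =
    mk⇔ (λ E → proj₁ (to E)) (λ b₁≡ → from (b₁≡ , λ _ 2≤i i≤1 → ⊥-elim (<⇒≱ (n<1+n 1) (≤-trans 2≤i i≤1))))
    where open Equivalence (ExceptionalTuple-even (0 , refl))

  ExceptionalTuple-1 : ExceptionalTuple a t 1 ⇔ (b a t 1 ≡ natℚ 0 × b a t 2 ≡ natℚ (a 2))
  ExceptionalTuple-1 = mk⇔
    (λ E → proj₁ (to E 1 ≤-refl (s≤s z≤n)) (0 , refl) , proj₂ (to E 2 (s≤s z≤n) ≤-refl) (1 , refl))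
    (λ (e₁ , e₂) → from (entries e₁ e₂))
    where
    open Equivalence (ExceptionalTuple-odd (0 , refl))
    entries : b a t 1 ≡ natℚ 0 → b a t 2 ≡ natℚ (a 2) → Pattern a (b a t) isOdd isEven 1 1
    entries e₁ _  1 _ _                   = (λ _ → e₁) , (λ e → ⊥-elim (¬isOdd∧isEven 1 (0 , refl) e))
    entries _  e₂ 2 _ _                   = (λ o → ⊥-elim (¬isOdd∧isEven 2 o (1 , refl))) , (λ _ → e₂)
    entries _  _  (suc (suc (suc _))) _ (s≤s (s≤s ()))

  ExceptionalTuple-2+ : ∀ k → ExceptionalTuple a t (2 + k) ⇔
    (ExceptionalTuple a t k × b a t (2 + k) ≡ natℚ 0 × b a t (3 + k) ≡ natℚ (a (3 + k)))
  ExceptionalTuple-2+ k with isOdd⊎isEven k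
  ... | inj₁ o = ⇔-trans (ExceptionalTuple-odd o₂)
                   (⇔-trans (Pattern-2+ {a} {b a t} {isOdd} {isEven} (s≤s z≤n) o₂ (¬isOdd∧isEven _ o₂) e₃
                                        (λ o₃ → ¬isOdd∧isEven _ o₃ e₃))
                            (⇔-sym (ExceptionalTuple-odd o) ×-⇔ ⇔-refl))
    where
    o₂ : isOdd (2 + k)
    o₂ = isOdd-2+ o
    e₃ : isEven (3 + k)
    e₃ = isOdd⇒isEven-suc o₂
  ... | inj₂ e = ⇔-trans (ExceptionalTuple-even e₂)
                   (⇔-trans (⇔-refl ×-⇔ Pattern-2+ {a} {b a t} {isEven} {isOdd} (s≤s (s≤s z≤n)) e₂
                                                   (λ o₂ → ¬isOdd∧isEven _ o₂ e₂) o₃ (¬isOdd∧isEven _ o₃))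
                            (mk⇔ (λ (b₁≡ , P , rest) → from (b₁≡ , P) , rest)
                                 (λ (E , rest) → proj₁ (to E) , proj₂ (to E) , rest)))
    where
    open Equivalence (ExceptionalTuple-even e)
    e₂ : isEven (2 + k)
    e₂ = isEven-2+ e
    o₃ : isOdd (3 + k)
    o₃ = isEven⇒isOdd-suc e₂

-- The words V_k of a sequence (t_k)

module _ (a : ℕ → ℕ) (pos : PositiveDigits a) (s t : ℕ → ℕ) (ts : IsTSeq a s t) where

  t<q : ∀ k → t k < q a k
  t<q k = proj₁ (ts k)

  t₀≡0 : t 0 ≡ 0
  t₀≡0 = n<1⇒n≡0 (t<q 0)

  V≈s : ∀ k i → suc i < q a k → at (V a t k) i ≡ s (suc i)
  V≈s k i 2+i≤q = begin
    at (V a t k) i                     ≡⟨ at-take (q a k ∸ 1) (V a t k) i i<q∸1 ⟨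
    at (take (q a k ∸ 1) (V a t k)) i  ≡⟨ cong (λ w → at w i) (proj₂ (ts k)) ⟩
    at (pref s (q a k ∸ 1)) i          ≡⟨ at-map-applyUpTo (λ j → s (suc j)) (λ j → j) (q a k ∸ 1) i i<q∸1 ⟩
    s (suc i)                          ∎
    where
    open ≡-Reasoning
    i<q∸1 : i < q a k ∸ 1
    i<q∸1 = ∸-monoˡ-≤ 1 2+i≤q

  Maximal : ℕ → Set
  Maximal k = t k ≡ q a k ∸ 1

  V-agree : ∀ k i → suc i < q a k → at (V a t k) i ≡ at (V a t (suc k)) i
  V-agree k i 2+i≤q = trans (V≈s k i 2+i≤q) (sym (V≈s (suc k) i (<-≤-trans 2+i≤q (q-mono a pos k))))

  record Transition (k : ℕ) : Set where
    field
      digit   : ℕ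
      t-step  : t (suc k) ≡ digit * q a k + t k
      prefix  : ¬ Maximal (suc k) → Prefix _≡_ (V a t k) (V a t (suc k))
      ¬prefix : Maximal (suc k) → ¬ Prefix _≡_ (V a t k) (V a t (suc k))

  transition₀ : Transition 0
  transition₀ = record
    { digit   = t 1
    ; t-step  = sym (trans (cong (t 1 * 1 +_) t₀≡0) (trans (+-identityʳ _) (*-identityʳ (t 1))))
    ; prefix  = λ ¬max → subst (λ w → Prefix _≡_ w (V a t 1)) (sym V₀≡0)
                  (at⇒Prefix (0 ∷ []) (V a t 1) 1≤|V₁| λ where
                     zero    _           → sym (trans V₁-head (first-letters (t₁<n ¬max)))
                     (suc i) (s≤s ()))
    ; ¬prefix = λ max P → 0≢1+n (trans (Prefix⇒at (subst (λ w → Prefix _≡_ w (V a t 1)) V₀≡0 P) 0 z<s)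
                  (trans V₁-head (trans (cong (at (M a 1)) (trans max (cong (_∸ 1) (q₁≡a₁ a)))) last-letter)))
    }
    where
    open ≡-Reasoning
    n : ℕ
    n = a 1 ∸ 1
    V₀≡0 : V a t 0 ≡ 0 ∷ []
    V₀≡0 = cong (conj a 0) t₀≡0
    t₁<|M₁| : t 1 < length (M a 1)
    t₁<|M₁| = subst (t 1 <_) (sym (length-M a pos 1)) (t<q 1)
    1≤|V₁| : 1 ≤ length (V a t 1)
    1≤|V₁| = subst (1 ≤_) (sym (length-rotate (M a 1) (t 1) (<⇒≤ t₁<|M₁|))) (<-≤-trans z<s t₁<|M₁|)
    V₁-head : at (V a t 1) 0 ≡ at (M a 1) (t 1)
    V₁-head = begin
      at (rotate (M a 1) (t 1)) 0      ≡⟨ at-rotate (M a 1) (t 1) 0 (<⇒≤ t₁<|M₁|) (<-≤-trans z<s t₁<|M₁|) ⟩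
      at (M a 1 ++ M a 1) (t 1 + 0)    ≡⟨ cong (at (M a 1 ++ M a 1)) (+-identityʳ (t 1)) ⟩
      at (M a 1 ++ M a 1) (t 1)        ≡⟨ at-++ˡ (M a 1) (M a 1) (t 1) t₁<|M₁| ⟩
      at (M a 1) (t 1)                 ∎
    first-letters : ∀ {x} → x < n → at (M a 1) x ≡ 0
    first-letters {x} x<n = trans (at-++ˡ (replicate n 0) (1 ∷ []) x (subst (x <_) (sym (length-replicate n)) x<n))
                                  (at-replicate n 0 x x<n)
    last-letter : at (M a 1) n ≡ 1
    last-letter = trans (cong (at (M a 1)) (sym (length-replicate n))) (at-++-length (replicate n 0) 1 [])
    t₁<n : ¬ Maximal 1 → t 1 < n
    t₁<n ¬max = ≤∧≢⇒< (∸-monoˡ-≤ 1 (subst (t 1 <_) (q₁≡a₁ a) (t<q 1)))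
                       (λ t₁≡n → ¬max (trans t₁≡n (cong (_∸ 1) (sym (q₁≡a₁ a)))))

  transition-suc : ∀ k → AlmostCommute (M a (suc k)) (M a k) → Transition (suc k)
  transition-suc k (u , c , d , c≢d , mm′≡ucd , m′m≡udc) = record
    { digit   = proj₁ offset
    ; t-step  = trans (proj₂ offset) (cong (λ x → proj₁ offset * x + t (suc k)) (length-M a pos (suc k)))
    ; prefix  = λ ¬max → to-M (rotate-Λ-prefix A 1≤A coprime t′ r t′< r<ℓ agree
                                 (λ t′≡ → ¬max (trans t′≡ (cong (_∸ 1) |Λ|≡q))))
    ; ¬prefix = λ max P → rotate-Λ-¬prefix A 1≤A coprime t′ r t′< r<ℓ agree
                            (trans max (cong (_∸ 1) (sym |Λ|≡q))) (from-M P)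
    }
    where
    m m′ : List ℕ
    m = M a (suc k)
    m′ = M a k
    A : ℕ
    A = a (2 + k)
    1≤A : 1 ≤ A
    1≤A = pos (2 + k) (s≤s z≤n)
    open AlmostCommutingPair m m′ u c d c≢d mm′≡ucd m′m≡udc
           (subst (1 ≤_) (sym (length-M a pos k)) (q≥1 a pos k))
           (subst₂ _≤_ (sym (length-M a pos k)) (sym (length-M a pos (suc k))) (q-mono a pos k))
    t′ r : ℕ
    t′ = t (2 + k)
    r = t (suc k)
    Λ≡M : Λ A ≡ M a (2 + k)
    Λ≡M = sym (M-step a k)
    to-M : ∀ {xs} → Prefix _≡_ xs (rotate (Λ A) t′) → Prefix _≡_ xs (V a t (2 + k))
    to-M {xs} = subst (λ w → Prefix _≡_ xs (rotate w t′)) Λ≡M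
    from-M : ∀ {xs} → Prefix _≡_ xs (V a t (2 + k)) → Prefix _≡_ xs (rotate (Λ A) t′)
    from-M {xs} = subst (λ w → Prefix _≡_ xs (rotate w t′)) (sym Λ≡M)
    |Λ|≡q : length (Λ A) ≡ q a (2 + k)
    |Λ|≡q = trans (cong length Λ≡M) (length-M a pos (2 + k))
    ℓ≡q : ℓ ≡ q a (suc k)
    ℓ≡q = length-M a pos (suc k)
    coprime : Coprime ℓ (sum m)
    coprime = subst₂ Coprime (sym ℓ≡q) (sym (sum-M a (suc k))) (Coprime-q-p a (suc k))
    t′< : t′ < length (Λ A)
    t′< = subst (t′ <_) (sym |Λ|≡q) (t<q (2 + k))
    r<ℓ : r < ℓ
    r<ℓ = subst (r <_) (sym ℓ≡q) (t<q (suc k))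
    agree : ∀ i → suc i < ℓ → at (rotate m r) i ≡ at (rotate (Λ A) t′) i
    agree i 2+i≤ℓ = subst (λ w → at (rotate m r) i ≡ at (rotate w t′) i) (sym Λ≡M)
                      (V-agree (suc k) i (subst (suc i <_) ℓ≡q 2+i≤ℓ))
    offset : ∃[ j ] t′ ≡ j * ℓ + r
    offset = rotate-Λ-offset A 1≤A coprime t′ r t′< r<ℓ agree

  transition : ∀ k → Transition k
  transition zero    = transition₀
  transition (suc k) = transition-suc k (M-AlmostCommute a k)

  digit : ℕ → ℕ
  digit k = Transition.digit (transition k)

  t-step : ∀ k → t (suc k) ≡ digit k * q a k + t k
  t-step k = Transition.t-step (transition k)

  b-suc≡digit : ∀ k → b a t (suc k) ≡ natℚ (digit k)
  b-suc≡digit zero    = refl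
  b-suc≡digit (suc k) =
    trans (cong (λ x → divℚ (ℤ.+ x ℤ.- ℤ.+ t (suc k)) (q a (suc k))) (t-step (suc k)))
          (divℚ-difference (digit (suc k)) (t (suc k)) (q a (suc k)) (q≥1 a pos (suc k)))

  digit≡⇔b≡ : ∀ k x → digit k ≡ x ⇔ b a t (suc k) ≡ natℚ x
  digit≡⇔b≡ k x = mk⇔ (λ e → trans (b-suc≡digit k) (cong natℚ e))
                      (λ e → natℚ-injective (trans (sym (b-suc≡digit k)) e))

  q∸1<q : ∀ k → q a k ∸ 1 < q a k
  q∸1<q k = ∸-monoʳ-< z<s (q≥1 a pos k)

  Maximal₁⇔ : Maximal 1 ⇔ digit 0 ≡ a 1 ∸ 1
  Maximal₁⇔ = mk⇔ (λ e → trans e (cong (_∸ 1) (q₁≡a₁ a))) (λ e → trans e (cong (_∸ 1) (sym (q₁≡a₁ a))))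

  -- Both are divisions by q_{k+1}: t_{k+2} = b_{k+2} q_{k+1} + t_{k+1}, q_{k+2} − 1 = a_{k+2} q_{k+1} + (q_k − 1).
  Maximal-2+⇔ : ∀ k → Maximal (2 + k) ⇔ (digit (suc k) ≡ a (2 + k) × digit k ≡ 0 × Maximal k)
  Maximal-2+⇔ k = mk⇔ to from
    where
    q∸1≡ : q a (2 + k) ∸ 1 ≡ a (2 + k) * q a (suc k) + (q a k ∸ 1)
    q∸1≡ = +-∸-assoc (a (2 + k) * q a (suc k)) (q≥1 a pos k)
    to : Maximal (2 + k) → digit (suc k) ≡ a (2 + k) × digit k ≡ 0 × Maximal k
    to max =
      let j≡a , t≡ = divMod-unique (digit (suc k)) (a (2 + k)) (t (suc k)) (q a k ∸ 1) (t<q (suc k))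
                       (<-≤-trans (q∸1<q k) (q-mono a pos k)) (trans (sym (t-step (suc k))) (trans max q∸1≡))
          j≡0 , max′ = divMod-unique (digit k) 0 (t k) (q a k ∸ 1) (t<q k) (q∸1<q k) (trans (sym (t-step k)) t≡)
      in j≡a , j≡0 , max′
    from : digit (suc k) ≡ a (2 + k) × digit k ≡ 0 × Maximal k → Maximal (2 + k)
    from (j≡a , j≡0 , max) = begin
      t (2 + k)                                      ≡⟨ t-step (suc k) ⟩
      digit (suc k) * q a (suc k) + t (suc k)        ≡⟨ cong₂ (λ x y → x * q a (suc k) + y) j≡a (t-step k) ⟩
      a (2 + k) * q a (suc k) + (digit k * q a k + t k)
        ≡⟨ cong₂ (λ x y → a (2 + k) * q a (suc k) + (x * q a k + y)) j≡0 max ⟩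
      a (2 + k) * q a (suc k) + (q a k ∸ 1)          ≡⟨ q∸1≡ ⟨
      q a (2 + k) ∸ 1                                ∎
      where open ≡-Reasoning

  Maximal-suc⇔ExceptionalTuple : ∀ k → Maximal (suc k) ⇔ ExceptionalTuple a t k
  Maximal-suc⇔ExceptionalTuple zero =
    ⇔-trans Maximal₁⇔ (⇔-trans (digit≡⇔b≡ 0 (a 1 ∸ 1)) (⇔-sym ExceptionalTuple-0))
  Maximal-suc⇔ExceptionalTuple (suc zero) = ⇔-trans (Maximal-2+⇔ 0) (⇔-trans
    (mk⇔ (λ (j₁≡ , j₀≡ , _) → to (digit≡⇔b≡ 0 0) j₀≡ , to (digit≡⇔b≡ 1 (a 2)) j₁≡)
         (λ (b₁≡ , b₂≡) → from (digit≡⇔b≡ 1 (a 2)) b₂≡ , from (digit≡⇔b≡ 0 0) b₁≡ , t₀≡0))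
    (⇔-sym ExceptionalTuple-1))
    where open Equivalence
  Maximal-suc⇔ExceptionalTuple (suc (suc k)) = ⇔-trans (Maximal-2+⇔ (suc k)) (⇔-trans
    (mk⇔ (λ (j≡ , j′≡ , max) → to (Maximal-suc⇔ExceptionalTuple k) max ,
                               to (digit≡⇔b≡ (suc k) 0) j′≡ , to (digit≡⇔b≡ (2 + k) (a (3 + k))) j≡)
         (λ (E , b≡ , b′≡) → from (digit≡⇔b≡ (2 + k) (a (3 + k))) b′≡ ,
                             from (digit≡⇔b≡ (suc k) 0) b≡ , from (Maximal-suc⇔ExceptionalTuple k) E))
    (⇔-sym (ExceptionalTuple-2+ k)))
    where open Equivalence

proposition5p2 : (a : ℕ → ℕ) → PositiveDigits a → (s : ℕ → ℕ) → Sturmian a s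
    → (t : ℕ → ℕ) → IsTSeq a s t → (k : ℕ)
    → (Prefix _≡_ (V a t k) (V a t (ℕ.suc k)) → ¬ ExceptionalTuple a t k)
    × (¬ ExceptionalTuple a t k → Prefix _≡_ (V a t k) (V a t (ℕ.suc k)))
proposition5p2 a pos s _ t ts k =
  (λ P E → Transition.¬prefix step (from E) P) , (λ ¬E → Transition.prefix step (λ max → ¬E (to max)))
  where
  step : Transition a pos s t ts k
  step = transition a pos s t ts k
  open Equivalence (Maximal-suc⇔ExceptionalTuple a pos s t ts k)
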